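{- For every integer $n\ge 0$, \[ D_{\mathcal{A}}(n) = b(n)\,e_{\mathcal{A}} + g(n)\quad\text{in } \mathcal{A}, \] where $(b(n))_{n\ge0}$ is the sequence of Bell numbers, defined by $b(0)=1$ and $b(n+1)=\sum_{k=0}^{n}\binom{n}{k}b(k)$ for $n\ge 0$, and $(g(n))_{n\ge 0}$ is the integer sequence defined by $g(0)=0$, $g(1)=1$ and $g(n+1)=\sum_{k=0}^{n}\binom{n}{k}g(k)$ for $n\ge 1$.
   Context: $\mathcal{A}\coloneqq\big(\prod_{p\text{ prime}}\mathbb{Z}/p\mathbb{Z}\big)/\big(\bigoplus_{p\text{ prime}}\mathbb{Z}/p\mathbb{Z}\big)$. Rational numbers are embedded diagonally, making $\mathcal{A}$ a $\mathbb{Q}$-algebra; for the finitely many primes $p$ dividing the denominator of a rational number, its $p$-component is assigned arbitrarily (this does not affect the element of $\mathcal{A}$). Define $D_{\mathcal{A}}(n)\coloneqq\big(\sum_{k=0}^{p-1}\frac{k^n}{k!}\bmod p\big)_p\in\mathcal{A}$ (with the convention $0^0=1$), and $e_{\mathcal{A}}\coloneqq D_{\mathcal{A}}(0)$. -}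

module Defs where

open import Data.Nat using (ℕ; zero; suc; _<_; _^_; _!)
open import Data.Nat.Primality using (Prime)
open import Data.Nat.Combinatorics using (_C_)
import Data.Nat as ℕ
open import Data.Integer as ℤ using (ℤ; +_)
open import Data.Integer.Divisibility using (_∣_)
open import Data.Product using (∃; _×_)

sumℕ : ℕ → (ℕ → ℕ) → ℕ
sumℕ zero    f = 0
sumℕ (suc m) f = sumℕ m f ℕ.+ f m

sumℤ : ℕ → (ℕ → ℤ) → ℤ
sumℤ zero    f = + 0
sumℤ (suc m) f = sumℤ m f ℤ.+ f m

CongMod : ℕ → ℤ → ℤ → Set
CongMod p a b = (+ p) ∣ (a ℤ.- b)

IsBell : (ℕ → ℕ) → Set
IsBell b = (b 0 ≡′ 1) × (∀ n → b (suc n) ≡′ sumℕ (suc n) (λ k → (n C k) ℕ.* b k))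
  where open import Relation.Binary.PropositionalEquality renaming (_≡_ to _≡′_)

IsG : (ℕ → ℕ) → Set
IsG g = (g 0 ≡′ 0) × (g 1 ≡′ 1)
      × (∀ n → 1 ℕ.≤ n → g (suc n) ≡′ sumℕ (suc n) (λ k → (n C k) ℕ.* g k))
  where open import Relation.Binary.PropositionalEquality renaming (_≡_ to _≡′_)

-- inv is a family of inverses of k! modulo p for 0 ≤ k < p
-- (so that Σ_k k^n · inv k is a representative of Σ_{k<p} k^n/k! in ℤ/pℤ)
FactInv : ℕ → (ℕ → ℤ) → Set
FactInv p inv = ∀ k → k < p → CongMod p ((+ (k !)) ℤ.* inv k) (+ 1)

-- p-component representative of D_A(n), given inverses of factorials mod p
Dp : ℕ → (ℕ → ℤ) → ℕ → ℤ
Dp p inv n = sumℤ p (λ k → (+ (k ^ n)) ℤ.* inv k)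

-- Two elements of A = (Π_p Z/p)/(⊕_p Z/p) given componentwise by representatives
-- x p inv, y p inv (depending on a choice of factorial inverses mod p) are equal iff
-- they agree mod p for all but finitely many primes p.
EqA : (ℕ → (ℕ → ℤ) → ℤ) → (ℕ → (ℕ → ℤ) → ℤ) → Set
EqA x y = ∃ λ N → ∀ p → Prime p → N < p → ∀ inv → FactInv p inv →
            CongMod p (x p inv) (y p inv)

module Submission where

-- Write p = m + 1 and D(n) = Σ_{k<p} kⁿ (k!)⁻¹ mod p. Since k (k!)⁻¹ = ((k−1)!)⁻¹,
-- shifting the summation index and expanding (j+1)ⁿ binomially gives
--   D(n+1) = Σᵢ C(n,i) D(i) − pⁿ ((p−1)!)⁻¹.
-- For n ≥ 1 the correction vanishes mod p, so D satisfies the Bell recurrence; for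
-- n = 0 Wilson's theorem (p−1)! ≡ −1 gives D(1) = D(0) + 1. Hence D and b(n) D(0) + g(n)
-- obey the same recurrence from the same two initial values, modulo every prime p.
-- Wilson's theorem comes from the finite-difference identity Σₖ (−1)ᵏ C(m,k) kᵐ = (−1)ᵐ m!,
-- read mod p using C(p−1,k) ≡ (−1)ᵏ and Fermat's little theorem.

open import Defs
open import Data.Nat using (ℕ)
open import Data.Integer using (ℤ; +_; _+_; _*_)

open import Data.Empty using (⊥-elim)
open import Data.Integer.Base as ℤ using (-_; _-_; _^_; -1ℤ; 0ℤ; 1ℤ)
import Data.Integer.Divisibility.Signed as S
import Data.Integer.Properties as ℤₚ
open import Algebra.Properties.CommutativeSemigroup ℤₚ.+-commutativeSemigroup
  using () renaming (interchange to +-interchange; x∙yz≈xz∙y to x+[y+z]≡[x+z]+y)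
open import Algebra.Properties.CommutativeSemigroup ℤₚ.*-commutativeSemigroup
  using () renaming (x∙yz≈y∙xz to x*[y*z]≡y*[x*z])
open import Data.Integer.Tactic.RingSolver using (solve-∀)
open import Data.Nat.Base as ℕ using (zero; suc; _!; _<_; _≤_; z≤n; s≤s)
open import Data.Nat.Combinatorics
  using (_C_; nCn≡1; nC1≡n; k>n⇒nCk≡0; nCk+nC[k+1]≡[n+1]C[k+1])
open import Data.Nat.Divisibility using (_∣_; divides; ∣⇒≤)
open import Data.Nat.Induction using (<-rec)
open import Data.Nat.Primality using (Prime; euclidsLemma; prime⇒nonTrivial)
import Data.Nat.Properties as ℕₚ
open import Data.Product.Base using (_,_)
open import Data.Sum.Base using (inj₁; inj₂; fromInj₂)
open import Function.Base using (_∘_)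
open import Relation.Binary.Bundles using (Setoid)
open import Relation.Binary.PropositionalEquality
open import Relation.Nullary.Negation using (¬_)

sumℤ-cong : ∀ m {f g : ℕ → ℤ} → (∀ k → k < m → f k ≡ g k) → sumℤ m f ≡ sumℤ m g
sumℤ-cong zero    f≡g = refl
sumℤ-cong (suc m) f≡g =
  cong₂ _+_ (sumℤ-cong m (λ k k<m → f≡g k (ℕₚ.m<n⇒m<1+n k<m))) (f≡g m (ℕₚ.n<1+n m))

sumℤ-zero : ∀ m → sumℤ m (λ _ → 0ℤ) ≡ 0ℤ
sumℤ-zero zero    = refl
sumℤ-zero (suc m) = trans (ℤₚ.+-identityʳ _) (sumℤ-zero m)

sumℤ-const : ∀ m c → sumℤ m (λ _ → c) ≡ + m * c
sumℤ-const zero    c = sym (ℤₚ.*-zeroˡ c)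
sumℤ-const (suc m) c = begin
  sumℤ m (λ _ → c) + c  ≡⟨ cong (_+ c) (sumℤ-const m c) ⟩
  + m * c + c           ≡⟨ ℤₚ.+-comm (+ m * c) c ⟩
  c + + m * c           ≡⟨ ℤₚ.suc-* (+ m) c ⟨
  + suc m * c           ∎
  where open ≡-Reasoning

sumℤ-+ : ∀ m (f g : ℕ → ℤ) → sumℤ m (λ k → f k + g k) ≡ sumℤ m f + sumℤ m g
sumℤ-+ zero    f g = refl
sumℤ-+ (suc m) f g =
  trans (cong (_+ (f m + g m)) (sumℤ-+ m f g)) (+-interchange (sumℤ m f) (sumℤ m g) (f m) (g m))

*-distribˡ-sumℤ : ∀ m c (f : ℕ → ℤ) → c * sumℤ m f ≡ sumℤ m (λ k → c * f k)
*-distribˡ-sumℤ zero    c f = ℤₚ.*-zeroʳ c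
*-distribˡ-sumℤ (suc m) c f =
  trans (ℤₚ.*-distribˡ-+ c (sumℤ m f) (f m)) (cong (_+ c * f m) (*-distribˡ-sumℤ m c f))

*-distribʳ-sumℤ : ∀ m c (f : ℕ → ℤ) → sumℤ m f * c ≡ sumℤ m (λ k → f k * c)
*-distribʳ-sumℤ zero    c f = refl
*-distribʳ-sumℤ (suc m) c f =
  trans (ℤₚ.*-distribʳ-+ c (sumℤ m f) (f m)) (cong (_+ f m * c) (*-distribʳ-sumℤ m c f))

sumℤ-suc : ∀ m (f : ℕ → ℤ) → sumℤ (suc m) f ≡ f 0 + sumℤ m (λ k → f (suc k))
sumℤ-suc zero    f = trans (ℤₚ.+-identityˡ (f 0)) (sym (ℤₚ.+-identityʳ (f 0)))
sumℤ-suc (suc m) f =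
  trans (cong (_+ f (suc m)) (sumℤ-suc m f)) (ℤₚ.+-assoc (f 0) _ (f (suc m)))

sumℤ-comm : ∀ m n (F : ℕ → ℕ → ℤ) →
  sumℤ m (λ j → sumℤ n (F j)) ≡ sumℤ n (λ i → sumℤ m (λ j → F j i))
sumℤ-comm zero    n F = sym (sumℤ-zero n)
sumℤ-comm (suc m) n F =
  trans (cong (_+ sumℤ n (F m)) (sumℤ-comm m n F))
        (sym (sumℤ-+ n (λ i → sumℤ m (λ j → F j i)) (F m)))

pos-sumℕ : ∀ m (f : ℕ → ℕ) → + sumℕ m f ≡ sumℤ m (λ k → + f k)
pos-sumℕ zero    f = refl
pos-sumℕ (suc m) f = trans (ℤₚ.pos-+ (sumℕ m f) (f m)) (cong (_+ + f m) (pos-sumℕ m f))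

pos-^ : ∀ k n → + (k ℕ.^ n) ≡ (+ k) ^ n
pos-^ k zero    = refl
pos-^ k (suc n) = trans (ℤₚ.pos-* k (k ℕ.^ n)) (cong (+ k *_) (pos-^ k n))

0^n≡0 : ∀ n → .{{ℕ.NonZero n}} → 0ℤ ^ n ≡ 0ℤ
0^n≡0 (suc n) = refl

[-1]^n*[-1]^n≡1 : ∀ n → -1ℤ ^ n * -1ℤ ^ n ≡ 1ℤ
[-1]^n*[-1]^n≡1 zero    = refl
[-1]^n*[-1]^n≡1 (suc n) = trans (square-neg (-1ℤ ^ n)) ([-1]^n*[-1]^n≡1 n)
  where
  square-neg : ∀ s → (-1ℤ * s) * (-1ℤ * s) ≡ s * s
  square-neg = solve-∀

[k+1]*[n+1]C[k+1]≡[n+1]*nCk : ∀ n k → suc k ℕ.* (suc n C suc k) ≡ suc n ℕ.* (n C k)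
[k+1]*[n+1]C[k+1]≡[n+1]*nCk zero    zero    = refl
[k+1]*[n+1]C[k+1]≡[n+1]*nCk zero    (suc k) = begin
  suc (suc k) ℕ.* (1 C suc (suc k))
    ≡⟨ cong (suc (suc k) ℕ.*_) (k>n⇒nCk≡0 {1} {suc (suc k)} (s≤s (s≤s z≤n))) ⟩
  suc (suc k) ℕ.* 0
    ≡⟨ ℕₚ.*-zeroʳ (suc (suc k)) ⟩
  0
    ≡⟨ k>n⇒nCk≡0 {0} {suc k} (s≤s z≤n) ⟨
  1 ℕ.* (0 C suc k)
    ∎
  where open ≡-Reasoning
[k+1]*[n+1]C[k+1]≡[n+1]*nCk (suc n) zero    =
  trans (ℕₚ.*-identityˡ _) (trans (nC1≡n (suc (suc n))) (sym (ℕₚ.*-identityʳ (suc (suc n)))))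
[k+1]*[n+1]C[k+1]≡[n+1]*nCk (suc n) (suc k) = begin
  suc (suc k) ℕ.* (suc (suc n) C suc (suc k))
    ≡⟨ cong (suc (suc k) ℕ.*_) (nCk+nC[k+1]≡[n+1]C[k+1] (suc n) (suc k)) ⟨
  suc (suc k) ℕ.* (a ℕ.+ b)
    ≡⟨ ℕₚ.*-distribˡ-+ (suc (suc k)) a b ⟩
  (a ℕ.+ suc k ℕ.* a) ℕ.+ suc (suc k) ℕ.* b
    ≡⟨ cong₂ (λ u v → (a ℕ.+ u) ℕ.+ v)
             ([k+1]*[n+1]C[k+1]≡[n+1]*nCk n k) ([k+1]*[n+1]C[k+1]≡[n+1]*nCk n (suc k)) ⟩
  (a ℕ.+ suc n ℕ.* (n C k)) ℕ.+ suc n ℕ.* (n C suc k)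
    ≡⟨ ℕₚ.+-assoc a _ _ ⟩
  a ℕ.+ (suc n ℕ.* (n C k) ℕ.+ suc n ℕ.* (n C suc k))
    ≡⟨ cong (a ℕ.+_) (ℕₚ.*-distribˡ-+ (suc n) (n C k) (n C suc k)) ⟨
  a ℕ.+ suc n ℕ.* (n C k ℕ.+ n C suc k)
    ≡⟨ cong (λ c → a ℕ.+ suc n ℕ.* c) (nCk+nC[k+1]≡[n+1]C[k+1] n k) ⟩
  suc (suc n) ℕ.* (suc n C suc k)
    ∎
  where
  open ≡-Reasoning
  a = suc n C suc k
  b = suc n C suc (suc k)

sumℤ-pascal : ∀ n (f : ℕ → ℤ) →
  sumℤ (suc (suc n)) (λ k → + (suc n C k) * f k) ≡
  sumℤ (suc n) (λ k → + (n C k) * f k) + sumℤ (suc n) (λ k → + (n C k) * f (suc k))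
sumℤ-pascal n f = begin
  sumℤ (suc (suc n)) (λ k → + (suc n C k) * f k)
    ≡⟨ sumℤ-suc (suc n) _ ⟩
  1ℤ * f 0 + sumℤ (suc n) (λ k → + (suc n C suc k) * f (suc k))
    ≡⟨ cong (_+_ (1ℤ * f 0)) (trans (sumℤ-cong (suc n) (λ k _ → pascal k)) (sumℤ-+ (suc n) _ g)) ⟩
  1ℤ * f 0 + (S + sumℤ (suc n) g)
    ≡⟨ cong (λ c → 1ℤ * f 0 + (S + (sumℤ n g + + c * f (suc n)))) (k>n⇒nCk≡0 {n} {suc n} ℕₚ.≤-refl) ⟩
  1ℤ * f 0 + (S + (sumℤ n g + 0ℤ))
    ≡⟨ cong (λ s → 1ℤ * f 0 + (S + s)) (ℤₚ.+-identityʳ (sumℤ n g)) ⟩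
  1ℤ * f 0 + (S + sumℤ n g)
    ≡⟨ x+[y+z]≡[x+z]+y (1ℤ * f 0) S (sumℤ n g) ⟩
  (1ℤ * f 0 + sumℤ n g) + S
    ≡⟨ cong (_+ S) (sumℤ-suc n (λ k → + (n C k) * f k)) ⟨
  sumℤ (suc n) (λ k → + (n C k) * f k) + S
    ∎
  where
  open ≡-Reasoning
  S = sumℤ (suc n) (λ k → + (n C k) * f (suc k))
  g : ℕ → ℤ
  g k = + (n C suc k) * f (suc k)
  pascal : ∀ k → + (suc n C suc k) * f (suc k) ≡ + (n C k) * f (suc k) + g k
  pascal k = begin
    + (suc n C suc k) * f (suc k)
      ≡⟨ cong (λ c → + c * f (suc k)) (nCk+nC[k+1]≡[n+1]C[k+1] n k) ⟨
    + (n C k ℕ.+ n C suc k) * f (suc k)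
      ≡⟨ cong (_* f (suc k)) (ℤₚ.pos-+ (n C k) (n C suc k)) ⟩
    (+ (n C k) + + (n C suc k)) * f (suc k)
      ≡⟨ ℤₚ.*-distribʳ-+ (f (suc k)) (+ (n C k)) (+ (n C suc k)) ⟩
    + (n C k) * f (suc k) + g k
      ∎

binomial : ∀ x n → (1ℤ + x) ^ n ≡ sumℤ (suc n) (λ k → + (n C k) * x ^ k)
binomial x zero    = refl
binomial x (suc n) = begin
  (1ℤ + x) * (1ℤ + x) ^ n
    ≡⟨ cong ((1ℤ + x) *_) (binomial x n) ⟩
  (1ℤ + x) * S
    ≡⟨ ℤₚ.*-distribʳ-+ S 1ℤ x ⟩
  1ℤ * S + x * S
    ≡⟨ cong₂ _+_ (ℤₚ.*-identityˡ S) (*-distribˡ-sumℤ (suc n) x (λ k → + (n C k) * x ^ k)) ⟩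
  S + sumℤ (suc n) (λ k → x * (+ (n C k) * x ^ k))
    ≡⟨ cong (_+_ S) (sumℤ-cong (suc n) (λ k _ → x*[y*z]≡y*[x*z] x (+ (n C k)) (x ^ k))) ⟩
  S + sumℤ (suc n) (λ k → + (n C k) * x ^ suc k)
    ≡⟨ sumℤ-pascal n (x ^_) ⟨
  sumℤ (suc (suc n)) (λ k → + (suc n C k) * x ^ k)
    ∎
  where
  open ≡-Reasoning
  S = sumℤ (suc n) (λ k → + (n C k) * x ^ k)

binomialTransform : (ℕ → ℤ) → ℕ → ℤ
binomialTransform x n = sumℤ (suc n) (λ i → + (n C i) * x i)

binomialTransform-+ : ∀ (x y : ℕ → ℤ) n →
  binomialTransform (λ i → x i + y i) n ≡ binomialTransform x n + binomialTransform y n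
binomialTransform-+ x y n =
  trans (sumℤ-cong (suc n) (λ i _ → ℤₚ.*-distribˡ-+ (+ (n C i)) (x i) (y i))) (sumℤ-+ (suc n) _ _)

binomialTransform-*ʳ : ∀ (x : ℕ → ℤ) c n →
  binomialTransform (λ i → x i * c) n ≡ binomialTransform x n * c
binomialTransform-*ʳ x c n =
  trans (sumℤ-cong (suc n) (λ i _ → sym (ℤₚ.*-assoc (+ (n C i)) (x i) c)))
        (sym (*-distribʳ-sumℤ (suc n) c (λ i → + (n C i) * x i)))

pos-binomialTransform : ∀ (a : ℕ → ℕ) n →
  + sumℕ (suc n) (λ k → (n C k) ℕ.* a k) ≡ binomialTransform (+_ ∘ a) n
pos-binomialTransform a n =
  trans (pos-sumℕ (suc n) _) (sumℤ-cong (suc n) (λ k _ → ℤₚ.pos-* (n C k) (a k)))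

-- (−1)ᴹ times the M-th forward difference of x ↦ xʲ at 0.
Δ : ℕ → ℕ → ℤ
Δ M j = sumℤ (suc M) (λ k → -1ℤ ^ k * + (M C k) * (+ k) ^ j)

Δ-suc : ∀ M j → Δ (suc M) (suc j) ≡ - + suc M * binomialTransform (Δ M) j
Δ-suc M j = begin
  Δ (suc M) (suc j)
    ≡⟨ trans (sumℤ-suc (suc M) t) (ℤₚ.+-identityˡ _) ⟩
  sumℤ (suc M) (λ k → t (suc k))
    ≡⟨ sumℤ-cong (suc M) (λ k _ → term k) ⟩
  sumℤ (suc M) (λ k → - + suc M * sumℤ (suc j) (λ l → + (j C l) * u k l))
    ≡⟨ *-distribˡ-sumℤ (suc M) (- + suc M) _ ⟨
  - + suc M * sumℤ (suc M) (λ k → sumℤ (suc j) (λ l → + (j C l) * u k l))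
    ≡⟨ cong (- + suc M *_) (sumℤ-comm (suc M) (suc j) (λ k l → + (j C l) * u k l)) ⟩
  - + suc M * sumℤ (suc j) (λ l → sumℤ (suc M) (λ k → + (j C l) * u k l))
    ≡⟨ cong (- + suc M *_)
            (sumℤ-cong (suc j) (λ l _ → *-distribˡ-sumℤ (suc M) (+ (j C l)) (λ k → u k l))) ⟨
  - + suc M * binomialTransform (Δ M) j
    ∎
  where
  open ≡-Reasoning
  t : ℕ → ℤ
  t k = -1ℤ ^ k * + (suc M C k) * (+ k) ^ suc j
  u : ℕ → ℕ → ℤ
  u k l = -1ℤ ^ k * + (M C k) * (+ k) ^ l
  regroup : ∀ s a c y → -1ℤ * s * c * (a * y) ≡ - (a * c) * (s * y)
  regroup = solve-∀
  regroup′ : ∀ N c s y → - (N * c) * (s * y) ≡ - N * (s * c * y)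
  regroup′ = solve-∀
  term : ∀ k → t (suc k) ≡ - + suc M * sumℤ (suc j) (λ l → + (j C l) * u k l)
  term k = begin
    -1ℤ * -1ℤ ^ k * + (suc M C suc k) * (+ suc k * (+ suc k) ^ j)
      ≡⟨ regroup (-1ℤ ^ k) (+ suc k) (+ (suc M C suc k)) ((+ suc k) ^ j) ⟩
    - (+ suc k * + (suc M C suc k)) * (-1ℤ ^ k * (+ suc k) ^ j)
      ≡⟨ cong (λ c → - c * (-1ℤ ^ k * (+ suc k) ^ j)) absorb ⟩
    - (+ suc M * + (M C k)) * (-1ℤ ^ k * (1ℤ + + k) ^ j)
      ≡⟨ regroup′ (+ suc M) (+ (M C k)) (-1ℤ ^ k) ((1ℤ + + k) ^ j) ⟩
    - + suc M * (w * (1ℤ + + k) ^ j)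
      ≡⟨ cong (λ y → - + suc M * (w * y)) (binomial (+ k) j) ⟩
    - + suc M * (w * sumℤ (suc j) (λ l → + (j C l) * (+ k) ^ l))
      ≡⟨ cong (- + suc M *_) (*-distribˡ-sumℤ (suc j) w _) ⟩
    - + suc M * sumℤ (suc j) (λ l → w * (+ (j C l) * (+ k) ^ l))
      ≡⟨ cong (- + suc M *_) (sumℤ-cong (suc j) (λ l _ → x*[y*z]≡y*[x*z] w (+ (j C l)) ((+ k) ^ l))) ⟩
    - + suc M * sumℤ (suc j) (λ l → + (j C l) * u k l)
      ∎
    where
    w = -1ℤ ^ k * + (M C k)
    absorb : + suc k * + (suc M C suc k) ≡ + suc M * + (M C k)
    absorb = begin
      + suc k * + (suc M C suc k)          ≡⟨ ℤₚ.pos-* (suc k) _ ⟨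
      + (suc k ℕ.* (suc M C suc k))        ≡⟨ cong +_ ([k+1]*[n+1]C[k+1]≡[n+1]*nCk M k) ⟩
      + (suc M ℕ.* (M C k))                ≡⟨ ℤₚ.pos-* (suc M) (M C k) ⟩
      + suc M * + (M C k)                  ∎

Δ-vanishes : ∀ M j → j < M → Δ M j ≡ 0ℤ
Δ-vanishes (suc M) zero    _     = begin
  Δ (suc M) 0
    ≡⟨ sumℤ-cong (suc (suc M)) (λ k _ → swap (-1ℤ ^ k) (+ (suc M C k))) ⟩
  sumℤ (suc (suc M)) (λ k → + (suc M C k) * -1ℤ ^ k)
    ≡⟨ binomial -1ℤ (suc M) ⟨
  0ℤ
    ∎
  where
  open ≡-Reasoning
  swap : ∀ s c → s * c * 1ℤ ≡ c * s
  swap = solve-∀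
Δ-vanishes (suc M) (suc j) j<M = begin
  Δ (suc M) (suc j)                                ≡⟨ Δ-suc M j ⟩
  - + suc M * binomialTransform (Δ M) j            ≡⟨ cong (- + suc M *_) (sumℤ-cong (suc j) vanish) ⟩
  - + suc M * sumℤ (suc j) (λ _ → 0ℤ)              ≡⟨ cong (- + suc M *_) (sumℤ-zero (suc j)) ⟩
  - + suc M * 0ℤ                                   ≡⟨ ℤₚ.*-zeroʳ (- + suc M) ⟩
  0ℤ                                               ∎
  where
  open ≡-Reasoning
  vanish : ∀ l → l < suc j → + (j C l) * Δ M l ≡ 0ℤ
  vanish l l<1+j = trans (cong (+ (j C l) *_) (Δ-vanishes M l (ℕₚ.<-≤-trans l<1+j (ℕ.s≤s⁻¹ j<M))))
                         (ℤₚ.*-zeroʳ (+ (j C l)))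

Δ-diagonal : ∀ M → Δ M M ≡ -1ℤ ^ M * + (M !)
Δ-diagonal zero    = refl
Δ-diagonal (suc M) = begin
  Δ (suc M) (suc M)
    ≡⟨ Δ-suc M M ⟩
  - + suc M * (sumℤ M (λ l → + (M C l) * Δ M l) + + (M C M) * Δ M M)
    ≡⟨ cong₂ (λ s c → - + suc M * (s + + c * Δ M M)) lower-terms (nCn≡1 M) ⟩
  - + suc M * (0ℤ + 1ℤ * Δ M M)
    ≡⟨ cong (λ d → - + suc M * (0ℤ + 1ℤ * d)) (Δ-diagonal M) ⟩
  - + suc M * (0ℤ + 1ℤ * (-1ℤ ^ M * + (M !)))
    ≡⟨ regroup (+ suc M) (-1ℤ ^ M) (+ (M !)) ⟩
  -1ℤ * -1ℤ ^ M * (+ suc M * + (M !))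
    ≡⟨ cong (-1ℤ * -1ℤ ^ M *_) (ℤₚ.pos-* (suc M) (M !)) ⟨
  -1ℤ ^ suc M * + (suc M !)
    ∎
  where
  open ≡-Reasoning
  lower-terms : sumℤ M (λ l → + (M C l) * Δ M l) ≡ 0ℤ
  lower-terms = trans (sumℤ-cong M vanish) (sumℤ-zero M)
    where
    vanish : ∀ l → l < M → + (M C l) * Δ M l ≡ 0ℤ
    vanish l l<M = trans (cong (+ (M C l) *_) (Δ-vanishes M l l<M)) (ℤₚ.*-zeroʳ (+ (M C l)))
  regroup : ∀ N s f → - N * (0ℤ + 1ℤ * (s * f)) ≡ -1ℤ * s * (N * f)
  regroup = solve-∀

module Modular (p : ℕ) where

  infix 4 _≈_
  record _≈_ (a b : ℤ) : Set where
    constructor mk≈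
    field divides-difference : + p S.∣ a - b

  open _≈_ public

  private
    via : ∀ {a b c} → c ≡ a - b → + p S.∣ c → a ≈ b
    via refl = mk≈

  ≈-refl : ∀ {a} → a ≈ a
  ≈-refl {a} = via (sym (ℤₚ.+-inverseʳ a)) (S.divides 0ℤ refl)

  ≈-reflexive : ∀ {a b} → a ≡ b → a ≈ b
  ≈-reflexive refl = ≈-refl

  ≈-sym : ∀ {a b} → a ≈ b → b ≈ a
  ≈-sym {a} {b} (mk≈ p∣a-b) = via (flip a b) (S.∣m⇒∣-m p∣a-b)
    where
    flip : ∀ a b → - (a - b) ≡ b - a
    flip = solve-∀

  ≈-trans : ∀ {a b c} → a ≈ b → b ≈ c → a ≈ c
  ≈-trans {a} {b} {c} (mk≈ p∣a-b) (mk≈ p∣b-c) =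
    via (ℤₚ.+-minus-telescope a b c) (S.∣m∣n⇒∣m+n p∣a-b p∣b-c)

  ≈-setoid : Setoid _ _
  ≈-setoid = record
    { Carrier       = ℤ
    ; _≈_           = _≈_
    ; isEquivalence = record { refl = ≈-refl ; sym = ≈-sym ; trans = ≈-trans }
    }

  +-cong : ∀ {a b c d} → a ≈ b → c ≈ d → a + c ≈ b + d
  +-cong {a} {b} {c} {d} (mk≈ p∣a-b) (mk≈ p∣c-d) =
    via (regroup a b c d) (S.∣m∣n⇒∣m+n p∣a-b p∣c-d)
    where
    regroup : ∀ a b c d → (a - b) + (c - d) ≡ (a + c) - (b + d)
    regroup = solve-∀

  -‿cong : ∀ {a b} → a ≈ b → - a ≈ - b
  -‿cong {a} {b} (mk≈ p∣a-b) = via (regroup a b) (S.∣m⇒∣-m p∣a-b)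
    where
    regroup : ∀ a b → - (a - b) ≡ - a - - b
    regroup = solve-∀

  *-cong : ∀ {a b c d} → a ≈ b → c ≈ d → a * c ≈ b * d
  *-cong {a} {b} {c} {d} (mk≈ p∣a-b) (mk≈ p∣c-d) =
    via (regroup a b c d) (S.∣m∣n⇒∣m+n (S.∣n⇒∣m*n a p∣c-d) (S.∣m⇒∣m*n d p∣a-b))
    where
    regroup : ∀ a b c d → a * (c - d) + (a - b) * d ≡ a * c - b * d
    regroup = solve-∀

  +-cancelʳ-≈ : ∀ {a b c d} → a + c ≈ b + d → c ≈ d → a ≈ b
  +-cancelʳ-≈ {a} {b} {c} {d} (mk≈ p∣sum) (mk≈ p∣c-d) =
    via (regroup a b c d) (S.∣m∣n⇒∣m-n p∣sum p∣c-d)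
    where
    regroup : ∀ a b c d → (a + c) - (b + d) - (c - d) ≡ a - b
    regroup = solve-∀

  sumℤ-cong-≈ : ∀ m {f g : ℕ → ℤ} → (∀ k → k < m → f k ≈ g k) → sumℤ m f ≈ sumℤ m g
  sumℤ-cong-≈ zero    f≈g = ≈-refl
  sumℤ-cong-≈ (suc m) f≈g =
    +-cong (sumℤ-cong-≈ m (λ k k<m → f≈g k (ℕₚ.m<n⇒m<1+n k<m))) (f≈g m (ℕₚ.n<1+n m))

  ∣⇒≈0 : ∀ {a} → + p S.∣ a → a ≈ 0ℤ
  ∣⇒≈0 {a} = via (sym (ℤₚ.+-identityʳ a))

  p≈0 : + p ≈ 0ℤ
  p≈0 = ∣⇒≈0 S.∣-refl

  CongMod⇒≈ : ∀ {a b} → CongMod p a b → a ≈ b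
  CongMod⇒≈ = mk≈ ∘ S.∣ᵤ⇒∣

  ≈⇒CongMod : ∀ {a b} → a ≈ b → CongMod p a b
  ≈⇒CongMod = S.∣⇒∣ᵤ ∘ divides-difference

  open import Relation.Binary.Reasoning.Setoid ≈-setoid public

  binomial-recurrence⇒≈ : ∀ {x y : ℕ → ℤ} → x 0 ≈ y 0 → x 1 ≈ y 1 →
    (∀ n → x (suc (suc n)) ≈ binomialTransform x (suc n)) →
    (∀ n → y (suc (suc n)) ≈ binomialTransform y (suc n)) →
    ∀ n → x n ≈ y n
  binomial-recurrence⇒≈ {x} {y} x₀≈y₀ x₁≈y₁ x-rec y-rec = <-rec _ step
    where
    step : ∀ n → (∀ {i} → i < n → x i ≈ y i) → x n ≈ y n
    step zero          _  = x₀≈y₀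
    step (suc zero)    _  = x₁≈y₁
    step (suc (suc n)) ih = begin
      x (suc (suc n))
        ≈⟨ x-rec n ⟩
      binomialTransform x (suc n)
        ≈⟨ sumℤ-cong-≈ (suc (suc n)) (λ i i<2+n → *-cong (≈-refl {+ (suc n C i)}) (ih i<2+n)) ⟩
      binomialTransform y (suc n)
        ≈⟨ y-rec n ⟨
      y (suc (suc n))
        ∎

module PrimeModulus (m : ℕ) (p-prime : Prime (suc m)) where

  p : ℕ
  p = suc m

  open Modular p public

  1<p : 1 < p
  1<p = ℕ.nonTrivial⇒n>1 p {{prime⇒nonTrivial p-prime}}

  instance
    m-nonZero : ℕ.NonZero m
    m-nonZero = ℕ.>-nonZero (ℕ.s≤s⁻¹ 1<p)

  p∤[1+k] : ∀ k → suc k < p → ¬ p ∣ suc k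
  p∤[1+k] k 1+k<p p∣1+k = ℕₚ.<⇒≱ 1+k<p (∣⇒≤ p∣1+k)

  p∤k! : ∀ k → k < p → ¬ p ∣ k !
  p∤k! zero    _   = p∤[1+k] 0 1<p
  p∤k! (suc k) 1+k<p p∣[1+k]! with euclidsLemma (suc k) (k !) p-prime p∣[1+k]!
  ... | inj₁ p∣1+k = p∤[1+k] k 1+k<p p∣1+k
  ... | inj₂ p∣k!  = p∤k! k (ℕₚ.<-trans (ℕₚ.n<1+n k) 1+k<p) p∣k!

  *-cancelˡ-≈ : ∀ c {x y} → ¬ p ∣ ℤ.∣ c ∣ → c * x ≈ c * y → x ≈ y
  *-cancelˡ-≈ c {x} {y} p∤c (mk≈ p∣cx-cy) = mk≈ (S.∣ᵤ⇒∣ p∣x-y)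
    where
    factor : ∀ c x y → c * x - c * y ≡ c * (x - y)
    factor = solve-∀
    p∣∣c∣*∣x-y∣ : p ∣ ℤ.∣ c ∣ ℕ.* ℤ.∣ x - y ∣
    p∣∣c∣*∣x-y∣ =
      subst (p ∣_) (ℤₚ.abs-* c (x - y)) (S.∣⇒∣ᵤ (subst (+ p S.∣_) (factor c x y) p∣cx-cy))
    p∣x-y : p ∣ ℤ.∣ x - y ∣
    p∣x-y = fromInj₂ (⊥-elim ∘ p∤c) (euclidsLemma ℤ.∣ c ∣ ℤ.∣ x - y ∣ p-prime p∣∣c∣*∣x-y∣)

  pC[1+k]≈0 : ∀ k → suc k < p → + (p C suc k) ≈ 0ℤ
  pC[1+k]≈0 k 1+k<p = ∣⇒≈0 (S.∣ᵤ⇒∣ p∣pC[1+k])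
    where
    p∣[1+k]*pC[1+k] : p ∣ suc k ℕ.* (p C suc k)
    p∣[1+k]*pC[1+k] =
      divides (m C k) (trans ([k+1]*[n+1]C[k+1]≡[n+1]*nCk m k) (ℕₚ.*-comm p (m C k)))
    p∣pC[1+k] : p ∣ p C suc k
    p∣pC[1+k] = fromInj₂ (⊥-elim ∘ p∤[1+k] k 1+k<p)
                         (euclidsLemma (suc k) (p C suc k) p-prime p∣[1+k]*pC[1+k])

  freshman's-dream : ∀ x → (1ℤ + x) ^ p ≈ 1ℤ + x ^ p
  freshman's-dream x = begin
    (1ℤ + x) ^ p
      ≡⟨ binomial x p ⟩
    sumℤ p f + f p
      ≡⟨ cong (_+ f p) (sumℤ-suc m f) ⟩
    (1ℤ + sumℤ m (λ k → f (suc k))) + f p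
      ≈⟨ +-cong (+-cong (≈-refl {1ℤ}) middle-terms) (≈-reflexive last-term) ⟩
    1ℤ + x ^ p
      ∎
    where
    f : ℕ → ℤ
    f k = + (p C k) * x ^ k
    middle-terms : sumℤ m (λ k → f (suc k)) ≈ 0ℤ
    middle-terms = begin
      sumℤ m (λ k → f (suc k))
        ≈⟨ sumℤ-cong-≈ m (λ k k<m → *-cong (pC[1+k]≈0 k (s≤s k<m)) (≈-refl {x ^ suc k})) ⟩
      sumℤ m (λ _ → 0ℤ)
        ≡⟨ sumℤ-zero m ⟩
      0ℤ
        ∎
    last-term : f p ≡ x ^ p
    last-term = trans (cong (λ c → + c * x ^ p) (nCn≡1 p)) (ℤₚ.*-identityˡ (x ^ p))

  fermat : ∀ a → (+ a) ^ p ≈ + a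
  fermat zero    = ≈-refl
  fermat (suc a) = begin
    (1ℤ + + a) ^ p    ≈⟨ freshman's-dream (+ a) ⟩
    1ℤ + (+ a) ^ p    ≈⟨ +-cong (≈-refl {1ℤ}) (fermat a) ⟩
    1ℤ + + a          ∎

  [1+k]^m≈1 : ∀ k → suc k < p → (+ suc k) ^ m ≈ 1ℤ
  [1+k]^m≈1 k 1+k<p = *-cancelˡ-≈ (+ suc k) (p∤[1+k] k 1+k<p) (begin
    + suc k * (+ suc k) ^ m   ≈⟨ fermat (suc k) ⟩
    + suc k                   ≡⟨ ℤₚ.*-identityʳ (+ suc k) ⟨
    + suc k * 1ℤ              ∎)

  -- The freshman's dream at x = −1; this also covers p = 2.
  [-1]^m≈1 : -1ℤ ^ m ≈ 1ℤ
  [-1]^m≈1 = begin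
    -1ℤ ^ m
      ≡⟨ regroup (-1ℤ ^ m) ⟩
    -1ℤ * (1ℤ + -1ℤ ^ p) + 1ℤ
      ≈⟨ +-cong (*-cong (≈-refl { -1ℤ}) (≈-sym (freshman's-dream -1ℤ))) (≈-refl {1ℤ}) ⟩
    -1ℤ * 0ℤ ^ p + 1ℤ
      ≡⟨⟩
    1ℤ
      ∎
    where
    regroup : ∀ s → s ≡ -1ℤ * (1ℤ + -1ℤ * s) + 1ℤ
    regroup = solve-∀

  mCk≈[-1]^k : ∀ k → k ≤ m → + (m C k) ≈ -1ℤ ^ k
  mCk≈[-1]^k zero    _     = ≈-refl
  mCk≈[-1]^k (suc k) 1+k≤m = begin
    + (m C suc k)
      ≡⟨ regroup (+ (m C k)) (+ (m C suc k)) ⟩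
    (+ (m C k) + + (m C suc k)) - + (m C k)
      ≡⟨ cong (λ c → c - + (m C k)) (ℤₚ.pos-+ (m C k) (m C suc k)) ⟨
    + (m C k ℕ.+ m C suc k) - + (m C k)
      ≡⟨ cong (λ c → + c - + (m C k)) (nCk+nC[k+1]≡[n+1]C[k+1] m k) ⟩
    + (p C suc k) - + (m C k)
      ≈⟨ +-cong (pC[1+k]≈0 k (s≤s 1+k≤m)) (-‿cong (mCk≈[-1]^k k (ℕₚ.<⇒≤ 1+k≤m))) ⟩
    0ℤ - -1ℤ ^ k
      ≡⟨ ℤₚ.+-identityˡ (- -1ℤ ^ k) ⟩
    - -1ℤ ^ k
      ≡⟨ ℤₚ.-1*i≡-i (-1ℤ ^ k) ⟨
    -1ℤ ^ suc k
      ∎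
    where
    regroup : ∀ a b → b ≡ (a + b) - a
    regroup = solve-∀

  wilson : + (m !) ≈ -1ℤ
  wilson = begin
    + (m !)                           ≡⟨ ℤₚ.*-identityˡ (+ (m !)) ⟨
    1ℤ * + (m !)                      ≈⟨ *-cong (≈-sym [-1]^m≈1) (≈-refl {+ (m !)}) ⟩
    -1ℤ ^ m * + (m !)                 ≡⟨ Δ-diagonal m ⟨
    Δ m m                             ≡⟨ sumℤ-suc m t ⟩
    t 0 + sumℤ m (λ k → t (suc k))    ≡⟨ cong (λ z → 1ℤ * z + sumℤ m (λ k → t (suc k))) (0^n≡0 m) ⟩
    0ℤ + sumℤ m (λ k → t (suc k))     ≈⟨ +-cong (≈-refl {0ℤ}) (sumℤ-cong-≈ m unit-terms) ⟩
    0ℤ + sumℤ m (λ _ → 1ℤ)            ≡⟨ cong (_+_ 0ℤ) (sumℤ-const m 1ℤ) ⟩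
    0ℤ + + m * 1ℤ                     ≡⟨ trans (ℤₚ.+-identityˡ _) (ℤₚ.*-identityʳ (+ m)) ⟩
    + p + -1ℤ                         ≈⟨ +-cong p≈0 (≈-refl { -1ℤ}) ⟩
    -1ℤ                               ∎
    where
    t : ℕ → ℤ
    t k = -1ℤ ^ k * + (m C k) * (+ k) ^ m
    unit-terms : ∀ k → k < m → t (suc k) ≈ 1ℤ
    unit-terms k k<m = begin
      -1ℤ ^ suc k * + (m C suc k) * (+ suc k) ^ m
        ≈⟨ *-cong (*-cong (≈-refl { -1ℤ ^ suc k}) (mCk≈[-1]^k (suc k) k<m)) ([1+k]^m≈1 k (s≤s k<m)) ⟩
      -1ℤ ^ suc k * -1ℤ ^ suc k * 1ℤ
        ≡⟨ ℤₚ.*-identityʳ _ ⟩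
      -1ℤ ^ suc k * -1ℤ ^ suc k
        ≡⟨ [-1]^n*[-1]^n≡1 (suc k) ⟩
      1ℤ
        ∎

  module FactorialInverses (inv : ℕ → ℤ) (inv-fact : FactInv p inv) where

    k!*inv[k]≈1 : ∀ k → k < p → + (k !) * inv k ≈ 1ℤ
    k!*inv[k]≈1 k k<p = CongMod⇒≈ (inv-fact k k<p)

    inv[m]≈-1 : inv m ≈ -1ℤ
    inv[m]≈-1 = begin
      inv m                      ≡⟨ regroup (inv m) ⟩
      -1ℤ * (-1ℤ * inv m)        ≈⟨ *-cong (≈-refl { -1ℤ}) (*-cong (≈-sym wilson) (≈-refl {inv m})) ⟩
      -1ℤ * (+ (m !) * inv m)    ≈⟨ *-cong (≈-refl { -1ℤ}) (k!*inv[k]≈1 m (ℕₚ.n<1+n m)) ⟩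
      -1ℤ * 1ℤ                   ≡⟨⟩
      -1ℤ                        ∎
      where
      regroup : ∀ i → i ≡ -1ℤ * (-1ℤ * i)
      regroup = solve-∀

    [1+k]*inv[1+k]≈inv[k] : ∀ k → suc k < p → + suc k * inv (suc k) ≈ inv k
    [1+k]*inv[1+k]≈inv[k] k 1+k<p = *-cancelˡ-≈ (+ (k !)) (p∤k! k k<p) (begin
      + (k !) * (+ suc k * inv (suc k))   ≡⟨ regroup (+ (k !)) (+ suc k) (inv (suc k)) ⟩
      + suc k * + (k !) * inv (suc k)     ≡⟨ cong (_* inv (suc k)) (ℤₚ.pos-* (suc k) (k !)) ⟨
      + (suc k !) * inv (suc k)           ≈⟨ k!*inv[k]≈1 (suc k) 1+k<p ⟩
      1ℤ                                  ≈⟨ k!*inv[k]≈1 k k<p ⟨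
      + (k !) * inv k                     ∎)
      where
      k<p = ℕₚ.<-trans (ℕₚ.n<1+n k) 1+k<p
      regroup : ∀ a b c → a * (b * c) ≡ b * a * c
      regroup = solve-∀

    D : ℕ → ℤ
    D n = sumℤ p (λ k → (+ k) ^ n * inv k)

    Dp≡D : ∀ n → Dp p inv n ≡ D n
    Dp≡D n = sumℤ-cong p (λ k _ → cong (_* inv k) (pos-^ k n))

    D-suc : ∀ n → D (suc n) + (+ p) ^ n * inv m ≈ binomialTransform D n
    D-suc n = begin
      D (suc n) + (+ p) ^ n * inv m    ≈⟨ +-cong shift (≈-refl {(+ p) ^ n * inv m}) ⟩
      X + (+ p) ^ n * inv m            ≈⟨ split ⟨
      binomialTransform D n            ∎
      where
      A : ℕ → ℤ
      A i = sumℤ m (λ j → (+ j) ^ i * inv j)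
      X = binomialTransform A n
      shift : D (suc n) ≈ X
      shift = begin
        D (suc n)
          ≡⟨ trans (sumℤ-suc m _) (ℤₚ.+-identityˡ _) ⟩
        sumℤ m (λ j → (+ suc j) ^ suc n * inv (suc j))
          ≈⟨ sumℤ-cong-≈ m lower-index ⟩
        sumℤ m (λ j → (1ℤ + + j) ^ n * inv j)
          ≈⟨ sumℤ-cong-≈ m (λ j _ → expand j) ⟩
        sumℤ m (λ j → sumℤ (suc n) (λ i → + (n C i) * ((+ j) ^ i * inv j)))
          ≡⟨ sumℤ-comm m (suc n) (λ j i → + (n C i) * ((+ j) ^ i * inv j)) ⟩
        sumℤ (suc n) (λ i → sumℤ m (λ j → + (n C i) * ((+ j) ^ i * inv j)))
          ≡⟨ sumℤ-cong (suc n) (λ i _ → *-distribˡ-sumℤ m (+ (n C i)) (λ j → (+ j) ^ i * inv j)) ⟨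
        X ∎
        where
        regroup : ∀ a y i → a * y * i ≡ y * (a * i)
        regroup = solve-∀
        lower-index : ∀ j → j < m → (+ suc j) ^ suc n * inv (suc j) ≈ (1ℤ + + j) ^ n * inv j
        lower-index j j<m = begin
          (+ suc j) ^ suc n * inv (suc j)      ≡⟨ regroup (+ suc j) ((+ suc j) ^ n) (inv (suc j)) ⟩
          (+ suc j) ^ n * (+ suc j * inv (suc j))
            ≈⟨ *-cong (≈-refl {(+ suc j) ^ n}) ([1+k]*inv[1+k]≈inv[k] j (s≤s j<m)) ⟩
          (1ℤ + + j) ^ n * inv j               ∎
        expand : ∀ j → (1ℤ + + j) ^ n * inv j ≈ sumℤ (suc n) (λ i → + (n C i) * ((+ j) ^ i * inv j))
        expand j = begin
          (1ℤ + + j) ^ n * inv j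
            ≡⟨ cong (_* inv j) (binomial (+ j) n) ⟩
          sumℤ (suc n) (λ i → + (n C i) * (+ j) ^ i) * inv j
            ≡⟨ *-distribʳ-sumℤ (suc n) (inv j) _ ⟩
          sumℤ (suc n) (λ i → + (n C i) * (+ j) ^ i * inv j)
            ≡⟨ sumℤ-cong (suc n) (λ i _ → ℤₚ.*-assoc (+ (n C i)) _ _) ⟩
          sumℤ (suc n) (λ i → + (n C i) * ((+ j) ^ i * inv j))
            ∎
      split : binomialTransform D n ≈ X + (+ p) ^ n * inv m
      split = begin
        binomialTransform D n
          ≡⟨ binomialTransform-+ A (λ i → (+ m) ^ i * inv m) n ⟩
        X + binomialTransform (λ i → (+ m) ^ i * inv m) n
          ≡⟨ cong (_+_ X) (binomialTransform-*ʳ ((+ m) ^_) (inv m) n) ⟩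
        X + binomialTransform ((+ m) ^_) n * inv m
          ≡⟨ cong (λ y → X + y * inv m) (binomial (+ m) n) ⟨
        X + (+ p) ^ n * inv m
          ∎

    D-one : D 1 ≈ D 0 + 1ℤ
    D-one = +-cancelʳ-≈ (begin
      D 1 + 1ℤ * inv m               ≈⟨ D-suc 0 ⟩
      0ℤ + 1ℤ * D 0                  ≡⟨ regroup (D 0) ⟩
      D 0 + 1ℤ + 1ℤ * -1ℤ            ∎) (*-cong (≈-refl {1ℤ}) inv[m]≈-1)
      where
      regroup : ∀ d → 0ℤ + 1ℤ * d ≡ d + 1ℤ + 1ℤ * -1ℤ
      regroup = solve-∀

    D-suc-suc : ∀ n → D (suc (suc n)) ≈ binomialTransform D (suc n)
    D-suc-suc n = +-cancelʳ-≈ (begin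
      D (suc (suc n)) + (+ p) ^ suc n * inv m    ≈⟨ D-suc (suc n) ⟩
      binomialTransform D (suc n)                ≡⟨ ℤₚ.+-identityʳ _ ⟨
      binomialTransform D (suc n) + 0ℤ           ∎)
      (*-cong (*-cong p≈0 (≈-refl {(+ p) ^ n})) (≈-refl {inv m}))

    D≈bell : ∀ {b g} → IsBell b → IsG g → ∀ n → D n ≈ + b n * D 0 + + g n
    D≈bell {b} {g} (b₀ , b-rec) (g₀ , g₁ , g-rec) = binomial-recurrence⇒≈ T₀ T₁ D-suc-suc T-rec
      where
      T : ℕ → ℤ
      T i = + b i * D 0 + + g i
      b₁ : b 1 ≡ 1
      b₁ = trans (b-rec 0) (trans (ℕₚ.+-identityʳ (b 0)) b₀)
      T₀ : D 0 ≈ T 0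
      T₀ = begin
        D 0                  ≡⟨ regroup (D 0) ⟩
        1ℤ * D 0 + 0ℤ        ≡⟨ cong₂ (λ u v → + u * D 0 + + v) b₀ g₀ ⟨
        T 0                  ∎
        where
        regroup : ∀ d → d ≡ 1ℤ * d + 0ℤ
        regroup = solve-∀
      T₁ : D 1 ≈ T 1
      T₁ = begin
        D 1                  ≈⟨ D-one ⟩
        D 0 + 1ℤ             ≡⟨ cong (_+ 1ℤ) (ℤₚ.*-identityˡ (D 0)) ⟨
        1ℤ * D 0 + 1ℤ        ≡⟨ cong₂ (λ u v → + u * D 0 + + v) b₁ g₁ ⟨
        T 1                  ∎
      T-rec : ∀ n → T (suc (suc n)) ≈ binomialTransform T (suc n)
      T-rec n = begin
        + b (2 ℕ.+ n) * D 0 + + g (2 ℕ.+ n)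
          ≡⟨ cong₂ (λ u v → + u * D 0 + + v) (b-rec (suc n)) (g-rec (suc n) (s≤s z≤n)) ⟩
        + sumℕ (2 ℕ.+ n) (λ k → (suc n C k) ℕ.* b k) * D 0
          + + sumℕ (2 ℕ.+ n) (λ k → (suc n C k) ℕ.* g k)
          ≡⟨ cong₂ (λ u v → u * D 0 + v) (pos-binomialTransform b (suc n)) (pos-binomialTransform g (suc n)) ⟩
        binomialTransform (+_ ∘ b) (suc n) * D 0 + binomialTransform (+_ ∘ g) (suc n)
          ≡⟨ cong (_+ binomialTransform (+_ ∘ g) (suc n)) (binomialTransform-*ʳ (+_ ∘ b) (D 0) (suc n)) ⟨
        binomialTransform (λ i → + b i * D 0) (suc n) + binomialTransform (+_ ∘ g) (suc n)
          ≡⟨ binomialTransform-+ (λ i → + b i * D 0) (+_ ∘ g) (suc n) ⟨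
        binomialTransform T (suc n)
          ∎

    Dp-congruence : ∀ {b g} → IsBell b → IsG g → ∀ n →
      CongMod p (Dp p inv n) (+ b n * Dp p inv 0 + + g n)
    Dp-congruence {b} {g} isBell isG n = ≈⇒CongMod (begin
      Dp p inv n                   ≡⟨ Dp≡D n ⟩
      D n                          ≈⟨ D≈bell isBell isG n ⟩
      + b n * D 0 + + g n          ≡⟨ cong (λ d → + b n * d + + g n) (Dp≡D 0) ⟨
      + b n * Dp p inv 0 + + g n   ∎)

theorem1p1 : (b g : ℕ → ℕ) → IsBell b → IsG g → (n : ℕ) →
    EqA (λ p inv → Dp p inv n) (λ p inv → (+ b n) * Dp p inv 0 + (+ g n))
theorem1p1 b g isBell isG n = 0 , λ where
  zero ()
  (suc m) p-prime _ inv inv-fact →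
    PrimeModulus.FactorialInverses.Dp-congruence m p-prime inv inv-fact isBell isG n
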